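{- Let $0<c_1,c_2<1$ and $\eta>0$ be constants and let $m$ be a positive integer. Let $H$ be a $4$-partite $4$-graph with vertex classes $A,B,C,Z$ where $|A|=|B|=|C| = c_1 m$ and $|Z| = c_2 2^{m^3}$. If $$d_4(Z,(A\times B\times C)) \geq 2\eta,$$ then there exist $A'\subset A$, $B'\subset B$, $C'\subset C$, $Z'\subset Z$ with $|A'|=|B'|=|C'|=|Z'| = \beta\sqrt{\log |A|}$ such that every $4$-set with one vertex in each of $A',B',C',Z'$ is an edge of $H$; here $\beta>0$ is a (small) constant depending on $\eta$.
   Context: A $4$-partite $4$-graph with classes $A,B,C,Z$ is a $4$-graph on the disjoint union $A\cup B\cup C\cup Z$ in which every edge has exactly one vertex in each class. $d_4(Z,(A\times B\times C)) = |E(H)|/(|Z||A||B||C|)$. Logarithms are base $2$. -}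

module Defs where

open import Data.Nat using (ℕ; zero; suc; _+_; _*_)
open import Data.Bool using (Bool; true; false; if_then_else_)
open import Data.Fin using (Fin)
open import Data.List using (List; allFin; map)
open import Data.Nat.ListAction using (sum)
open import Data.Fin.Subset using (Subset; _∈_)
open import Relation.Binary.PropositionalEquality using (_≡_)

-- Since every edge has exactly one vertex in each class, H is determined by
-- its (decidable) edge indicator on A × B × C × Z.
FourPartite : ℕ → ℕ → ℕ → ℕ → Set
FourPartite a b c z = Fin a → Fin b → Fin c → Fin z → Bool

edgeCount : ∀ {a b c z} → FourPartite a b c z → ℕ
edgeCount {a} {b} {c} {z} H =
  sum (map (λ x → sum (map (λ y → sum (map (λ w → sum (map (λ t →
    if H x y w t then 1 else 0) (allFin z))) (allFin c))) (allFin b))) (allFin a))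

Complete : ∀ {a b c z} → FourPartite a b c z →
           Subset a → Subset b → Subset c → Subset z → Set
Complete H A' B' C' Z' =
  ∀ x y w t → x ∈ A' → y ∈ B' → w ∈ C' → t ∈ Z' → H x y w t ≡ true

-- The argument is a greedy Kővári–Sós–Turán step, iterated once per vertex class.
-- Let R be a bipartite graph between Fin n and a finite set Y with at least
-- 2^-f · n|Y| edges. Vertices y of degree below d = ⌊n / 2^(1+f)⌋ carry at most half
-- of the edges, so the set of y of degree ≥ d has density ≥ 2^-(1+f). Pick vertices
-- x₁, …, x_k one at a time: if P is the current common neighbourhood (inside that set)
-- of the j < k vertices already chosen, every y ∈ P has ≥ d − j ≥ d/2 neighbours among
-- the unchosen vertices, so by averaging some unchosen x keeps a fraction
-- d/(2n) ≥ 2^-(3+f) of P. This gives k vertices whose common neighbourhood has density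
-- ≥ 2^-(1+f+(3+f)k) in Y.
-- Applied to A against B × C × Z, then to B against C × Z inside that common
-- neighbourhood, then to C against Z and to Z against a point, this yields a complete
-- k × k × k × k subgraph. The density exponent grows like k^i s after i steps, which
-- the classes afford as long as k² ≲ log |A| and k³ ≲ log |Z| = m³.
{-# OPTIONS --safe #-}
module Submission where

open import Defs
open import Data.Bool using (Bool; true; false; T; if_then_else_; _∨_; _∧_; not)
open import Data.Bool.Properties using (∨-identityʳ; ¬-not; ∧-conicalˡ; ∧-conicalʳ)
  renaming (_≟_ to _≟ᵇ_)
open import Data.Fin using (Fin; zero; suc; _≟_)
open import Data.Fin.Properties using (all?; ¬∀⟶∃¬)
open import Data.Fin.Subset using (Subset; ∣_∣; _∈_; ⊥)
open import Data.Fin.Subset.Properties using (∣⊥∣≡0; ∉⊥)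
open import Data.List using (List; []; _∷_; allFin)
import Data.List as List
open import Data.List.Extrema.Nat using (argmax; f[xs]≤f[argmax])
open import Data.List.Membership.Propositional.Properties using (∈-allFin)
open import Data.List.Properties using (map-tabulate)
import Data.List.Relation.Unary.All as All
open import Data.Nat
  using (ℕ; zero; suc; _+_; _*_; _^_; _∸_; _≤_; _<_; _≤ᵇ_; z≤n; s≤s; NonZero; >-nonZero)
open import Data.Nat.DivMod using (_/_; _%_; m/n*n≤m; m*n/n≡m; /-monoˡ-≤; m≡m%n+[m/n]*n; m%n<n)
open import Data.Nat.ListAction using (product)
import Data.Nat.ListAction as ListAction
open import Data.Nat.Properties hiding (_≟_)
open import Algebra.Properties.CommutativeMonoid.Sum +-0-commutativeMonoid
  using (sum; sum-cong-≗) renaming (∑-distrib-+ to sum-distrib-+)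
open import Data.Nat.Tactic.RingSolver using (solve-∀)
open import Data.Product using (Σ; _×_; _,_; proj₁; proj₂; map₂)
open import Data.Unit using (⊤; tt)
import Data.Vec as Vec
open import Data.Vec.Properties using (lookup∘tabulate; []=⇒lookup)
open import Function using (_∘_)
open import Relation.Binary.PropositionalEquality
open import Relation.Nullary using (does; yes; no; contradiction; ofⁿ)

-- Written as in Defs.edgeCount, so that the two counts agree definitionally.
ind : Bool → ℕ
ind b = if b then 1 else 0

ind≤1 : ∀ b → ind b ≤ 1
ind≤1 true  = ≤-refl
ind≤1 false = z≤n

-- The greedy step only uses additivity of the sum over Y, so it is stated for an
-- abstract sum; it is then run with Y a product of the remaining vertex classes.
record Summation (Y : Set) : Set where
  field
    ∑ : (Y → ℕ) → ℕ
    ∑-cong : ∀ {f g} → (∀ y → f y ≡ g y) → ∑ f ≡ ∑ g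
    ∑-distrib-+ : ∀ f g → ∑ (λ y → f y + g y) ≡ ∑ f + ∑ g

  ∑-zero : ∑ (λ _ → 0) ≡ 0
  ∑-zero = +-cancelˡ-≡ (∑ (λ _ → 0)) _ 0 (trans (sym (∑-distrib-+ _ _)) (sym (+-identityʳ _)))

  ∑-mono : ∀ {f g} → (∀ y → f y ≤ g y) → ∑ f ≤ ∑ g
  ∑-mono {f} {g} f≤g = begin
    ∑ f                            ≤⟨ m≤m+n (∑ f) _ ⟩
    ∑ f + ∑ (λ y → g y ∸ f y)      ≡⟨ ∑-distrib-+ f _ ⟨
    ∑ (λ y → f y + (g y ∸ f y))    ≡⟨ ∑-cong (λ y → m+[n∸m]≡n (f≤g y)) ⟩
    ∑ g                            ∎
    where open ≤-Reasoning

  *-distribˡ-∑ : ∀ c f → c * ∑ f ≡ ∑ (λ y → c * f y)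
  *-distribˡ-∑ zero    f = sym ∑-zero
  *-distribˡ-∑ (suc c) f = trans (cong (∑ f +_) (*-distribˡ-∑ c f)) (sym (∑-distrib-+ f _))

  card : ℕ
  card = ∑ (λ _ → 1)

  ∑-const : ∀ c → ∑ (λ _ → c) ≡ c * card
  ∑-const c = trans (∑-cong (λ _ → sym (*-identityʳ c))) (sym (*-distribˡ-∑ c _))

  size : (Y → Bool) → ℕ
  size P = ∑ (ind ∘ P)

  ∑-sum-comm : ∀ {n} (g : Fin n → Y → ℕ) →
               ∑ (λ y → sum (λ x → g x y)) ≡ sum (λ x → ∑ (g x))
  ∑-sum-comm {zero}  g = ∑-zero
  ∑-sum-comm {suc n} g = trans (∑-distrib-+ _ _) (cong (∑ (g zero) +_) (∑-sum-comm (g ∘ suc)))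

finSummation : ∀ n → Summation (Fin n)
finSummation n = record { ∑ = sum ; ∑-cong = sum-cong-≗ ; ∑-distrib-+ = sum-distrib-+ }

unitSummation : Summation ⊤
unitSummation = record
  { ∑ = λ f → f tt ; ∑-cong = λ f≗g → f≗g tt ; ∑-distrib-+ = λ _ _ → refl }

_⊗_ : ∀ {X Y} → Summation X → Summation Y → Summation (X × Y)
S ⊗ S′ = record
  { ∑ = λ f → S.∑ (λ x → S′.∑ (λ y → f (x , y)))
  ; ∑-cong = λ f≗g → S.∑-cong (λ x → S′.∑-cong (λ y → f≗g (x , y)))
  ; ∑-distrib-+ = λ f g → trans (S.∑-cong (λ x → S′.∑-distrib-+ _ _)) (S.∑-distrib-+ _ _)
  }
  where
  module S = Summation S
  module S′ = Summation S′

module ∑ᶠ {n : ℕ} = Summation (finSummation n)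

card-Fin : ∀ n → ∑ᶠ.card {n} ≡ n
card-Fin zero    = refl
card-Fin (suc n) = cong suc (card-Fin n)

sum≤n*max : ∀ {n} (f : Fin n → ℕ) {c} → (∀ x → f x ≤ c) → sum f ≤ n * c
sum≤n*max {n} f {c} f≤c = begin
  sum f                ≤⟨ ∑ᶠ.∑-mono f≤c ⟩
  ∑ᶠ.∑ {n} (λ _ → c)   ≡⟨ ∑ᶠ.∑-const {n} c ⟩
  c * ∑ᶠ.card {n}      ≡⟨ cong (c *_) (card-Fin n) ⟩
  c * n                ≡⟨ *-comm c n ⟩
  n * c                ∎
  where open ≤-Reasoning

size-singleton : ∀ {n} (x₀ : Fin n) → ∑ᶠ.size (λ x → does (x ≟ x₀)) ≡ 1
size-singleton {suc n} zero     = cong suc (∑ᶠ.∑-zero {n})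
size-singleton {suc n} (suc x₀) = size-singleton x₀

insert : ∀ {n} → (Fin n → Bool) → Fin n → Fin n → Bool
insert A x₀ x = A x ∨ does (x ≟ x₀)

size-insert : ∀ {n} (A : Fin n → Bool) {x₀} → A x₀ ≡ false →
              ∑ᶠ.size (insert A x₀) ≡ suc (∑ᶠ.size A)
size-insert {n} A {x₀} A[x₀]≡false = begin
  ∑ᶠ.size (insert A x₀)                          ≡⟨ ∑ᶠ.∑-cong ind-insert ⟩
  ∑ᶠ.∑ (λ x → ind (A x) + ind (does (x ≟ x₀)))   ≡⟨ ∑ᶠ.∑-distrib-+ {n} _ _ ⟩
  ∑ᶠ.size A + ∑ᶠ.size (λ x → does (x ≟ x₀))
                                                 ≡⟨ cong (∑ᶠ.size A +_) (size-singleton x₀) ⟩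
  ∑ᶠ.size A + 1                                  ≡⟨ +-comm _ 1 ⟩
  suc (∑ᶠ.size A)                                ∎
  where
  open ≡-Reasoning
  ind-insert : ∀ x → ind (insert A x₀ x) ≡ ind (A x) + ind (does (x ≟ x₀))
  ind-insert x with x ≟ x₀
  ... | yes refl rewrite A[x₀]≡false = refl
  ... | no _     = trans (cong ind (∨-identityʳ (A x))) (sym (+-identityʳ _))

∃-outside : ∀ {n} (A : Fin n → Bool) → ∑ᶠ.size A < n → Σ (Fin n) λ x → A x ≡ false
∃-outside {n} A ∣A∣<n with all? (λ x → A x ≟ᵇ true)
... | yes A≡⊤ =
  contradiction (trans (∑ᶠ.∑-cong (λ x → cong ind (A≡⊤ x))) (card-Fin n)) (<⇒≢ ∣A∣<n)
... | no  A≢⊤ = map₂ ¬-not (¬∀⟶∃¬ n _ (λ x → A x ≟ᵇ true) A≢⊤)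

maximiser-outside : ∀ {n} (A : Fin n → Bool) (f : Fin n → ℕ) {x₁} → A x₁ ≡ false →
                    (∀ x → A x ≡ true → f x ≡ 0) →
                    Σ (Fin n) λ x → A x ≡ false × (∀ y → f y ≤ f x)
maximiser-outside {n} A f {x₁} A[x₁]≡false f[A]≡0 = choose (A m) refl
  where
  m : Fin n
  m = argmax f x₁ (allFin n)
  f≤f[m] : ∀ y → f y ≤ f m
  f≤f[m] y = All.lookup (f[xs]≤f[argmax] x₁ (allFin n)) (∈-allFin y)
  choose : ∀ b → A m ≡ b → Σ (Fin n) λ x → A x ≡ false × (∀ y → f y ≤ f x)
  choose false A[m]≡false = m , A[m]≡false , f≤f[m]
  choose true  A[m]≡true  = x₁ , A[x₁]≡false ,
    λ y → ≤-trans (f≤f[m] y) (subst (_≤ f x₁) (sym (f[A]≡0 m A[m]≡true)) z≤n)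

∣tabulate∣ : ∀ {n} (A : Fin n → Bool) → ∣ Vec.tabulate A ∣ ≡ ∑ᶠ.size A
∣tabulate∣ {zero}  A = refl
∣tabulate∣ {suc n} A with A zero
... | true  = cong suc (∣tabulate∣ (A ∘ suc))
... | false = ∣tabulate∣ (A ∘ suc)

∈-tabulate : ∀ {n} {A : Fin n → Bool} {x} → x ∈ Vec.tabulate A → A x ≡ true
∈-tabulate {A = A} {x} x∈A = trans (sym (lookup∘tabulate A x)) ([]=⇒lookup x∈A)

n≤2^n : ∀ n → n ≤ 2 ^ n
n≤2^n zero    = z≤n
n≤2^n (suc n) = +-mono-≤ (m^n>0 2 n) (≤-trans (n≤2^n n) (m≤m+n _ 0))

m*n≤o⇒m≤o/n : ∀ {m n o} .{{_ : NonZero n}} → m * n ≤ o → m ≤ o / n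
m*n≤o⇒m≤o/n {m} {n} {o} mn≤o = subst (_≤ o / n) (m*n/n≡m m n) (/-monoˡ-≤ n mn≤o)

o≤2*[o/n]*n : ∀ {n} o .{{_ : NonZero n}} → 1 ≤ o / n → o ≤ 2 * (o / n) * n
o≤2*[o/n]*n {n} o 1≤o/n = <⇒≤ (begin-strict
  o                        ≡⟨ m≡m%n+[m/n]*n o n ⟩
  o % n + o / n * n        <⟨ +-monoˡ-< (o / n * n) (m%n<n o n) ⟩
  n + o / n * n            ≤⟨ +-monoˡ-≤ (o / n * n) n≤[o/n]*n ⟩
  o / n * n + o / n * n    ≡⟨ lemma (o / n) n ⟩
  2 * (o / n) * n          ∎)
  where
  open ≤-Reasoning
  n≤[o/n]*n : n ≤ o / n * n
  n≤[o/n]*n = subst (_≤ o / n * n) (*-identityˡ n) (*-monoˡ-≤ n 1≤o/n)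
  lemma : ∀ d n → d * n + d * n ≡ 2 * d * n
  lemma = solve-∀

d≤2*[d∸j] : ∀ {d j} → 2 * j ≤ d → d ≤ 2 * (d ∸ j)
d≤2*[d∸j] {d} {j} 2j≤d = begin
  d                   ≡⟨ m∸n+n≡m j≤d ⟨
  (d ∸ j) + j         ≤⟨ +-monoʳ-≤ (d ∸ j) (m+n≤o⇒m≤o∸n j j+j≤d) ⟩
  (d ∸ j) + (d ∸ j)   ≡⟨ cong ((d ∸ j) +_) (+-identityʳ (d ∸ j)) ⟨
  2 * (d ∸ j)         ∎
  where
  open ≤-Reasoning
  j+j≤d : j + j ≤ d
  j+j≤d = subst (_≤ d) (cong (j +_) (+-identityʳ j)) 2j≤d
  j≤d : j ≤ d
  j≤d = m+n≤o⇒m≤o j j+j≤d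

[d∸j]p≤nq⇒p≤Dq : ∀ {n d D j p q} → 2 * suc j ≤ d → 2 * n ≤ D * d →
                 (d ∸ j) * p ≤ n * q → p ≤ D * q
[d∸j]p≤nq⇒p≤Dq {n} {d} {D} {j} {p} {q} 2[1+j]≤d 2n≤Dd [d∸j]p≤nq =
  *-cancelˡ-≤ d {{>-nonZero (≤-trans (s≤s z≤n) 2[1+j]≤d)}} (begin
    d * p               ≤⟨ *-monoˡ-≤ p (d≤2*[d∸j] {d} {j} 2j≤d) ⟩
    2 * (d ∸ j) * p     ≡⟨ *-assoc 2 (d ∸ j) p ⟩
    2 * ((d ∸ j) * p)   ≤⟨ *-monoʳ-≤ 2 [d∸j]p≤nq ⟩
    2 * (n * q)         ≡⟨ *-assoc 2 n q ⟨
    2 * n * q           ≤⟨ *-monoˡ-≤ q 2n≤Dd ⟩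
    D * d * q           ≡⟨ lemma D d q ⟩
    d * (D * q)         ∎)
  where
  open ≤-Reasoning
  2j≤d : 2 * j ≤ d
  2j≤d = ≤-trans (*-monoʳ-≤ 2 (n≤1+n j)) 2[1+j]≤d
  lemma : ∀ D d q → D * d * q ≡ d * (D * q)
  lemma = solve-∀

nc≤X[ns+dc]⇒c≤2Xs : ∀ {n c s d X} .{{_ : NonZero n}} →
                    n * c ≤ X * (n * s + d * c) → 2 * X * d ≤ n → c ≤ 2 * X * s
nc≤X[ns+dc]⇒c≤2Xs {n} {c} {s} {d} {X} h 2Xd≤n =
  *-cancelˡ-≤ n (+-cancelʳ-≤ (n * c) (n * c) (n * (2 * X * s)) (begin
    n * c + n * c                      ≡⟨ lemma₁ n c ⟩
    2 * (n * c)                        ≤⟨ *-monoʳ-≤ 2 h ⟩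
    2 * (X * (n * s + d * c))          ≡⟨ lemma₂ n c s d X ⟩
    n * (2 * X * s) + 2 * X * d * c    ≤⟨ +-monoʳ-≤ (n * (2 * X * s)) (*-monoˡ-≤ c 2Xd≤n) ⟩
    n * (2 * X * s) + n * c            ∎))
  where
  open ≤-Reasoning
  lemma₁ : ∀ n c → n * c + n * c ≡ 2 * (n * c)
  lemma₁ = solve-∀
  lemma₂ : ∀ n c s d X → 2 * (X * (n * s + d * c)) ≡ n * (2 * X * s) + 2 * X * d * c
  lemma₂ = solve-∀

next-exponent : ℕ → ℕ → ℕ
next-exponent k f = 1 + f + (3 + f) * k

2^[1+f]*[2^[3+f]]^k : ∀ k f p → 2 ^ (1 + f) * ((2 ^ (3 + f)) ^ k * p) ≡ 2 ^ next-exponent k f * p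
2^[1+f]*[2^[3+f]]^k k f p = begin
  2 ^ (1 + f) * ((2 ^ (3 + f)) ^ k * p)
    ≡⟨ cong (λ e → 2 ^ (1 + f) * (e * p)) (^-*-assoc 2 (3 + f) k) ⟩
  2 ^ (1 + f) * (2 ^ ((3 + f) * k) * p)    ≡⟨ *-assoc (2 ^ (1 + f)) _ p ⟨
  2 ^ (1 + f) * 2 ^ ((3 + f) * k) * p      ≡⟨ cong (_* p) (^-distribˡ-+-* 2 (1 + f) ((3 + f) * k)) ⟨
  2 ^ next-exponent k f * p                ∎
  where open ≡-Reasoning

module Bipartite {Y : Set} (S : Summation Y) {n : ℕ} (R : Fin n → Y → Bool) where
  open Summation S

  deg : Y → ℕ
  deg y = sum (λ x → ind (R x y))

  edges : ℕ
  edges = sum (λ x → size (R x))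

  CompleteTo : (Fin n → Bool) → (Y → Bool) → Set
  CompleteTo A P = ∀ {x y} → A x ≡ true → P y ≡ true → R x y ≡ true

  Rich : ℕ → Y → Bool
  Rich d y = d ≤ᵇ deg y

  ∑deg≤ : ∀ d → ∑ deg ≤ n * size (Rich d) + d * card
  ∑deg≤ d = begin
    ∑ deg                                        ≤⟨ ∑-mono deg≤ ⟩
    ∑ (λ y → n * ind (Rich d y) + d)             ≡⟨ ∑-distrib-+ _ _ ⟩
    ∑ (λ y → n * ind (Rich d y)) + ∑ (λ _ → d)   ≡⟨ cong₂ _+_ (sym (*-distribˡ-∑ n _)) (∑-const d) ⟩
    n * size (Rich d) + d * card                 ∎
    where
    open ≤-Reasoning
    deg≤ : ∀ y → deg y ≤ n * ind (Rich d y) + d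
    deg≤ y with d ≤ᵇ deg y | ≤ᵇ-reflects-≤ d (deg y)
    ... | true  | _      = ≤-trans (sum≤n*max _ (λ x → ind≤1 (R x y))) (m≤m+n _ d)
    ... | false | ofⁿ d≰ = ≤-trans (<⇒≤ (≰⇒> d≰)) (m≤n+m d _)

  card≤2^[1+f]*∣Rich∣ : ∀ {f d} .{{_ : NonZero n}} →
                        n * card ≤ 2 ^ f * edges → d * 2 ^ (1 + f) ≤ n →
                        card ≤ 2 ^ (1 + f) * size (Rich d)
  card≤2^[1+f]*∣Rich∣ {f} {d} dense-edges d2^[1+f]≤n =
    nc≤X[ns+dc]⇒c≤2Xs {n} {card} {size (Rich d)} {d} {2 ^ f}
      (≤-trans dense-edges (*-monoʳ-≤ (2 ^ f) (≤-trans (≤-reflexive edges≡∑deg) (∑deg≤ d))))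
      (≤-trans (≤-reflexive (lemma d (2 ^ f))) d2^[1+f]≤n)
    where
    edges≡∑deg : edges ≡ ∑ deg
    edges≡∑deg = sym (∑-sum-comm (λ x y → ind (R x y)))
    lemma : ∀ d x → 2 * x * d ≡ d * (2 * x)
    lemma = solve-∀

  -- The factor not (A x) makes this vanish on A, so a maximiser may be taken outside A.
  fresh-neighbours : (Fin n → Bool) → (Y → Bool) → Fin n → ℕ
  fresh-neighbours A P x = size (λ y → not (A x) ∧ (P y ∧ R x y))

  fresh-neighbours-on : ∀ A P x → A x ≡ true → fresh-neighbours A P x ≡ 0
  fresh-neighbours-on A P x x∈A rewrite x∈A = ∑-zero

  fresh-neighbours-off : ∀ A P {x} → A x ≡ false → fresh-neighbours A P x ≡ size (λ y → P y ∧ R x y)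
  fresh-neighbours-off A P x∉A rewrite x∉A = refl

  deg≤fresh+∣A∣ : ∀ (A : Fin n → Bool) y → deg y ≤ sum (λ x → ind (not (A x) ∧ R x y)) + ∑ᶠ.size A
  deg≤fresh+∣A∣ A y =
    ≤-trans (∑ᶠ.∑-mono (λ x → split (A x) (R x y))) (≤-reflexive (∑ᶠ.∑-distrib-+ {n} _ _))
    where
    split : ∀ a r → ind r ≤ ind (not a ∧ r) + ind a
    split true  true  = s≤s z≤n
    split true  false = z≤n
    split false r     = m≤m+n (ind r) 0

  ∑fresh-neighbours≥ : ∀ A P {d} → (∀ {y} → P y ≡ true → d ≤ deg y) →
                       (d ∸ ∑ᶠ.size A) * size P ≤ sum (fresh-neighbours A P)
  ∑fresh-neighbours≥ A P {d} P⊆Rich = begin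
    (d ∸ ∣A∣) * size P                            ≡⟨ *-distribˡ-∑ (d ∸ ∣A∣) _ ⟩
    ∑ (λ y → (d ∸ ∣A∣) * ind (P y))               ≤⟨ ∑-mono pointwise ⟩
    ∑ (λ y → sum (λ x → fresh-edge x y))          ≡⟨ ∑-sum-comm fresh-edge ⟩
    sum (fresh-neighbours A P)                    ∎
    where
    open ≤-Reasoning
    ∣A∣ : ℕ
    ∣A∣ = ∑ᶠ.size A
    fresh-edge : Fin n → Y → ℕ
    fresh-edge x y = ind (not (A x) ∧ (P y ∧ R x y))
    pointwise : ∀ y → (d ∸ ∣A∣) * ind (P y) ≤ sum (λ x → fresh-edge x y)
    pointwise y with P y in y∈P
    ... | false = ≤-trans (≤-reflexive (*-zeroʳ (d ∸ ∣A∣))) z≤n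
    ... | true  = begin
      (d ∸ ∣A∣) * 1          ≡⟨ *-identityʳ (d ∸ ∣A∣) ⟩
      d ∸ ∣A∣                ≤⟨ ∸-monoˡ-≤ ∣A∣ (≤-trans (P⊆Rich y∈P) (deg≤fresh+∣A∣ A y)) ⟩
      fresh + ∣A∣ ∸ ∣A∣      ≡⟨ m+n∸n≡m fresh ∣A∣ ⟩
      fresh                  ∎
      where
      fresh : ℕ
      fresh = sum (λ x → ind (not (A x) ∧ R x y))

  good-vertex : ∀ A P {d} → ∑ᶠ.size A < n → (∀ {y} → P y ≡ true → d ≤ deg y) →
                Σ (Fin n) λ x₀ → A x₀ ≡ false ×
                  (d ∸ ∑ᶠ.size A) * size P ≤ n * size (λ y → P y ∧ R x₀ y)
  good-vertex A P {d} ∣A∣<n P⊆Rich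
    with maximiser-outside A (fresh-neighbours A P) (proj₂ (∃-outside A ∣A∣<n)) (fresh-neighbours-on A P)
  ... | x₀ , A[x₀]≡false , maximal = x₀ , A[x₀]≡false , (begin
    (d ∸ ∑ᶠ.size A) * size P                  ≤⟨ ∑fresh-neighbours≥ A P P⊆Rich ⟩
    sum (fresh-neighbours A P)                ≤⟨ sum≤n*max _ maximal ⟩
    n * fresh-neighbours A P x₀               ≡⟨ cong (n *_) (fresh-neighbours-off A P A[x₀]≡false) ⟩
    n * size (λ y → P y ∧ R x₀ y)             ∎)
    where open ≤-Reasoning

  module Greedy (d D : ℕ) (2n≤Dd : 2 * n ≤ D * d) (d≤n : d ≤ n) where

    record Partial (j : ℕ) : Set where
      field
        A : Fin n → Bool
        P : Y → Bool
        ∣A∣≡j : ∑ᶠ.size A ≡ j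
        P⊆Rich : ∀ {y} → P y ≡ true → d ≤ deg y
        complete : CompleteTo A P
        dense : size (Rich d) ≤ D ^ j * size P

    start : Partial 0
    start = record
      { A = λ _ → false
      ; P = Rich d
      ; ∣A∣≡j = ∑ᶠ.∑-zero {n}
      ; P⊆Rich = λ {y} rich → ≤ᵇ⇒≤ d (deg y) (subst T (sym rich) tt)
      ; complete = λ ()
      ; dense = ≤-reflexive (sym (+-identityʳ _))
      }

    extend : ∀ {j} → 2 * suc j ≤ d → Partial j → Partial (suc j)
    extend {j} 2[1+j]≤d p = record
      { A = insert A x₀
      ; P = P′
      ; ∣A∣≡j = trans (size-insert A A[x₀]≡false) (cong suc ∣A∣≡j)
      ; P⊆Rich = λ y∈P′ → P⊆Rich (∧-conicalˡ _ _ y∈P′)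
      ; complete = complete′
      ; dense = begin
          size (Rich d)             ≤⟨ dense ⟩
          D ^ j * size P            ≤⟨ *-monoʳ-≤ (D ^ j) ∣P∣≤D∣P′∣ ⟩
          D ^ j * (D * size P′)     ≡⟨ lemma (D ^ j) D (size P′) ⟩
          D ^ suc j * size P′       ∎
      }
      where
      open Partial p
      open ≤-Reasoning
      ∣A∣<n : ∑ᶠ.size A < n
      ∣A∣<n = subst (_< n) (sym ∣A∣≡j) (≤-trans (≤-trans (m≤n*m (suc j) 2) 2[1+j]≤d) d≤n)
      chosen : Σ (Fin n) λ x₀ → A x₀ ≡ false × (d ∸ ∑ᶠ.size A) * size P ≤ n * size (λ y → P y ∧ R x₀ y)
      chosen = good-vertex A P ∣A∣<n P⊆Rich
      x₀ : Fin n
      x₀ = proj₁ chosen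
      A[x₀]≡false : A x₀ ≡ false
      A[x₀]≡false = proj₁ (proj₂ chosen)
      P′ : Y → Bool
      P′ y = P y ∧ R x₀ y
      ∣P∣≤D∣P′∣ : size P ≤ D * size P′
      ∣P∣≤D∣P′∣ = [d∸j]p≤nq⇒p≤Dq {n} {d} {D} 2[1+j]≤d 2n≤Dd
        (subst (λ i → (d ∸ i) * size P ≤ n * size P′) ∣A∣≡j (proj₂ (proj₂ chosen)))
      complete′ : CompleteTo (insert A x₀) P′
      complete′ {x} x∈A′ y∈P′ with x ≟ x₀
      ... | yes refl = ∧-conicalʳ _ _ y∈P′
      ... | no  _    = complete (trans (sym (∨-identityʳ (A x))) x∈A′) (∧-conicalˡ _ _ y∈P′)
      lemma : ∀ a b c → a * (b * c) ≡ b * a * c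
      lemma = solve-∀

    greedy : ∀ j → 2 * j ≤ d → Partial j
    greedy zero    _        = start
    greedy (suc j) 2[1+j]≤d = extend 2[1+j]≤d (greedy j (≤-trans (*-monoʳ-≤ 2 (n≤1+n j)) 2[1+j]≤d))

  record DenseCommonNeighbourhood (k f : ℕ) : Set where
    field
      A : Fin n → Bool
      P : Y → Bool
      ∣A∣≡k : ∑ᶠ.size A ≡ k
      complete : CompleteTo A P
      dense : card ≤ 2 ^ next-exponent k f * size P

  dense-common-neighbourhood : ∀ {k f} → 1 ≤ k → 2 ^ (2 + f) * k ≤ n →
                               n * card ≤ 2 ^ f * edges → DenseCommonNeighbourhood k f
  dense-common-neighbourhood {k} {f} 1≤k 2^[2+f]k≤n dense-edges = record
    { A = A ; P = P ; ∣A∣≡k = ∣A∣≡j ; complete = complete ; dense = begin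
      card                                  ≤⟨ card≤2^[1+f]*∣Rich∣ {f} {d} dense-edges dq≤n ⟩
      q * size (Rich d)                     ≤⟨ *-monoʳ-≤ q dense ⟩
      q * ((2 ^ (3 + f)) ^ k * size P)      ≡⟨ 2^[1+f]*[2^[3+f]]^k k f (size P) ⟩
      2 ^ next-exponent k f * size P        ∎ }
    where
    open ≤-Reasoning
    q : ℕ
    q = 2 ^ (1 + f)
    instance
      q≢0 : NonZero q
      q≢0 = >-nonZero (m^n>0 2 (1 + f))
    d : ℕ
    d = n / q
    dq≤n : d * q ≤ n
    dq≤n = m/n*n≤m n q
    d≤n : d ≤ n
    d≤n = ≤-trans (m≤m*n d q) dq≤n
    2k≤d : 2 * k ≤ d
    2k≤d = m*n≤o⇒m≤o/n (≤-trans (≤-reflexive (lemma₁ k (2 ^ f))) 2^[2+f]k≤n)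
      where
      lemma₁ : ∀ k x → 2 * k * (2 * x) ≡ 2 * (2 * x) * k
      lemma₁ = solve-∀
    1≤d : 1 ≤ d
    1≤d = ≤-trans (≤-trans 1≤k (m≤n*m k 2)) 2k≤d
    2n≤2^[3+f]d : 2 * n ≤ 2 ^ (3 + f) * d
    2n≤2^[3+f]d = ≤-trans (*-monoʳ-≤ 2 (o≤2*[o/n]*n n 1≤d)) (≤-reflexive (lemma₂ d (2 ^ f)))
      where
      lemma₂ : ∀ d x → 2 * (2 * d * (2 * x)) ≡ 2 * (2 * (2 * x)) * d
      lemma₂ = solve-∀
    instance
      n≢0 : NonZero n
      n≢0 = >-nonZero (≤-trans 1≤d d≤n)
    open Greedy d (2 ^ (3 + f)) 2n≤2^[3+f]d d≤n
    open Partial (greedy k 2k≤d)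

Tuple : List ℕ → Set
Tuple []       = ⊤
Tuple (n ∷ ns) = Fin n × Tuple ns

tupleSummation : ∀ ns → Summation (Tuple ns)
tupleSummation []       = unitSummation
tupleSummation (n ∷ ns) = finSummation n ⊗ tupleSummation ns

module ∑ᵗ {ns : List ℕ} = Summation (tupleSummation ns)

card-Tuple : ∀ ns → ∑ᵗ.card {ns} ≡ product ns
card-Tuple []       = refl
card-Tuple (n ∷ ns) = begin
  ∑ᶠ.∑ {n} (λ _ → ∑ᵗ.card {ns})  ≡⟨ ∑ᶠ.∑-const {n} _ ⟩
  ∑ᵗ.card {ns} * ∑ᶠ.card {n}     ≡⟨ cong₂ _*_ (card-Tuple ns) (card-Fin n) ⟩
  product ns * n                 ≡⟨ *-comm (product ns) n ⟩
  n * product ns                 ∎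
  where open ≡-Reasoning

Box : List ℕ → Set
Box []       = ⊤
Box (n ∷ ns) = Subset n × Box ns

_∈ᵇ_ : ∀ {ns} → Tuple ns → Box ns → Set
_∈ᵇ_ {[]}     _        _        = ⊤
_∈ᵇ_ {n ∷ ns} (x , xs) (A , As) = x ∈ A × xs ∈ᵇ As

Sides : ℕ → ∀ {ns} → Box ns → Set
Sides k {[]}     _        = ⊤
Sides k {n ∷ ns} (A , As) = ∣ A ∣ ≡ k × Sides k As

Large : ℕ → ℕ → List ℕ → Set
Large k f []       = ⊤
Large k f (n ∷ ns) = 2 ^ (2 + f) * k ≤ n × Large k (next-exponent k f) ns

record CompleteBox {ns} (H : Tuple ns → Bool) (k : ℕ) : Set where
  field
    box : Box ns
    sides : Sides k box
    box⊆H : ∀ {xs} → xs ∈ᵇ box → H xs ≡ true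

complete-box : ∀ ns (H : Tuple ns → Bool) {k f} → 1 ≤ k → Large k f ns →
               product ns ≤ 2 ^ f * ∑ᵗ.size H → CompleteBox H k
complete-box [] H {f = f} _ _ H-dense =
  record { box = tt ; sides = tt ; box⊆H = λ { {tt} _ → H[tt]≡true } }
  where
  H[tt]≡true : H tt ≡ true
  H[tt]≡true with H tt
  ... | true  = refl
  ... | false = contradiction (≤-trans H-dense (≤-reflexive (*-zeroʳ (2 ^ f)))) λ ()
complete-box (n ∷ ns) H {k} {f} 1≤k (large , large′) H-dense = record
  { box = Vec.tabulate A , box
  ; sides = trans (∣tabulate∣ A) ∣A∣≡k , sides
  ; box⊆H = λ { (x∈A , xs∈box) → complete (∈-tabulate x∈A) (box⊆H xs∈box) }
  }
  where
  open Bipartite (tupleSummation ns) (λ x xs → H (x , xs))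
  open DenseCommonNeighbourhood (dense-common-neighbourhood {k} {f} 1≤k large
         (subst (λ c → n * c ≤ 2 ^ f * ∑ᵗ.size H) (sym (card-Tuple ns)) H-dense))
  open CompleteBox (complete-box ns P 1≤k large′
         (subst (_≤ 2 ^ next-exponent k f * ∑ᵗ.size P) (card-Tuple ns) dense))

sum-tabulate : ∀ {n} (f : Fin n → ℕ) → ListAction.sum (List.tabulate f) ≡ sum f
sum-tabulate {zero}  f = refl
sum-tabulate {suc n} f = cong (f zero +_) (sum-tabulate (f ∘ suc))

sum-map-allFin : ∀ {n} {f g : Fin n → ℕ} → (∀ x → f x ≡ g x) →
                 ListAction.sum (List.map f (allFin n)) ≡ sum g
sum-map-allFin {f = f} f≗g =
  trans (cong ListAction.sum (map-tabulate (λ x → x) f)) (trans (sum-tabulate f) (sum-cong-≗ f≗g))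

module _ {a b c z : ℕ} (H : FourPartite a b c z) where

  H⁺ : Tuple (a ∷ b ∷ c ∷ z ∷ []) → Bool
  H⁺ (x , y , w , t , _) = H x y w t

  edgeCount≡size : edgeCount H ≡ ∑ᵗ.size H⁺
  edgeCount≡size =
    sum-map-allFin {g = λ x → ∑ᵗ.size {b ∷ c ∷ z ∷ []} (λ ys → H⁺ (x , ys))} λ x →
    sum-map-allFin {g = λ y → ∑ᵗ.size {c ∷ z ∷ []} (λ ys → H⁺ (x , y , ys))} λ y →
    sum-map-allFin {g = λ w → ∑ᵗ.size {z ∷ []} (λ ys → H⁺ (x , y , w , ys))} λ w →
    sum-map-allFin {g = λ t → ind (H x y w t)} λ t → refl

  CompleteSubgraph : ℕ → Set
  CompleteSubgraph k =
    Σ (Subset a) λ A′ → Σ (Subset b) λ B′ → Σ (Subset c) λ C′ → Σ (Subset z) λ Z′ →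
      ∣ A′ ∣ ≡ k × ∣ B′ ∣ ≡ k × ∣ C′ ∣ ≡ k × ∣ Z′ ∣ ≡ k × Complete H A′ B′ C′ Z′

  empty-subgraph : CompleteSubgraph 0
  empty-subgraph = ⊥ , ⊥ , ⊥ , ⊥ , ∣⊥∣≡0 a , ∣⊥∣≡0 b , ∣⊥∣≡0 c , ∣⊥∣≡0 z ,
                   λ _ _ _ _ x∈⊥ → contradiction x∈⊥ ∉⊥

  box⇒subgraph : ∀ {k} → CompleteBox H⁺ k → CompleteSubgraph k
  box⇒subgraph record { box   = A′ , B′ , C′ , Z′ , _
                      ; sides = ∣A′∣ , ∣B′∣ , ∣C′∣ , ∣Z′∣ , _
                      ; box⊆H = box⊆H } =
    A′ , B′ , C′ , Z′ , ∣A′∣ , ∣B′∣ , ∣C′∣ , ∣Z′∣ ,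
    λ _ _ _ _ x∈ y∈ w∈ t∈ → box⊆H (x∈ , y∈ , w∈ , t∈ , tt)

  complete-subgraph : ∀ {k f} → 1 ≤ k → Large k f (a ∷ b ∷ c ∷ z ∷ []) →
                      product (a ∷ b ∷ c ∷ z ∷ []) ≤ 2 ^ f * edgeCount H → CompleteSubgraph k
  complete-subgraph {k} {f} 1≤k large dense = box⇒subgraph (complete-box _ H⁺ {k} {f} 1≤k large
    (subst (λ e → a * (b * (c * (z * 1))) ≤ 2 ^ f * e) edgeCount≡size dense))

large-from-exponent : ∀ {f k q n e} .{{_ : NonZero q}} →
                      2 + f + k + q ≤ e → 2 ^ e ≤ n * q → 2 ^ (2 + f) * k ≤ n
large-from-exponent {f} {k} {q} {n} {e} exponent 2^e≤nq = *-cancelʳ-≤ _ n q (begin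
  2 ^ (2 + f) * k * q            ≤⟨ *-mono-≤ (*-monoʳ-≤ (2 ^ (2 + f)) (n≤2^n k)) (n≤2^n q) ⟩
  2 ^ (2 + f) * 2 ^ k * 2 ^ q    ≡⟨ cong (_* 2 ^ q) (^-distribˡ-+-* 2 (2 + f) k) ⟨
  2 ^ (2 + f + k) * 2 ^ q        ≡⟨ ^-distribˡ-+-* 2 (2 + f + k) q ⟨
  2 ^ (2 + f + k + q)            ≤⟨ ^-monoʳ-≤ 2 exponent ⟩
  2 ^ e                          ≤⟨ 2^e≤nq ⟩
  n * q                          ∎)
  where open ≤-Reasoning

next-exponent≤ : ∀ k f → 3 + next-exponent (suc k) f ≤ 3 * suc k * (3 + f)
next-exponent≤ k f = ≤-trans (m≤m+n _ (2 + f + 2 * k * (3 + f))) (≤-reflexive (lemma k f))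
  where
  lemma : ∀ k f → 3 + (1 + f + (3 + f) * suc k) + (2 + f + 2 * k * (3 + f)) ≡ 3 * suc k * (3 + f)
  lemma = solve-∀

-- The statement's β is u/v; we take u = 1 and v = β⁻¹ s q₂. Then v² ≥ 10(3 + s) makes the
-- three classes of size a large enough, and v ≥ 1 + 27(3 + s) + q₂ does the same for Z.
β⁻¹ : ℕ → ℕ → ℕ
β⁻¹ s q₂ = suc (27 * (3 + s) + q₂)

module ClassSizes (k s q₂ : ℕ) where
  K B v f₁ f₂ f₃ : ℕ
  K = suc k
  B = 3 + s
  v = β⁻¹ s q₂
  f₁ = next-exponent K s
  f₂ = next-exponent K f₁
  f₃ = next-exponent K f₂

  B≤KB : B ≤ K * B
  B≤KB = m≤n*m B K

  3+f₀≤ : 3 + s ≤ 9 * (K * K * B)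
  3+f₀≤ = ≤-trans (m≤n*m B 9) (*-monoʳ-≤ 9 (≤-trans B≤KB (*-monoˡ-≤ B (m≤m*n K K))))

  3+f₁≤ : 3 + f₁ ≤ 9 * (K * K * B)
  3+f₁≤ = ≤-trans (next-exponent≤ k s) (≤-trans (*-monoʳ-≤ (3 * K) B≤KB)
           (≤-trans (≤-reflexive (lemma K B)) (*-monoˡ-≤ (K * K * B) (m≤m+n 3 6))))
    where
    lemma : ∀ K B → 3 * K * (K * B) ≡ 3 * (K * K * B)
    lemma = solve-∀

  3+f₂≤ : 3 + f₂ ≤ 9 * (K * K * B)
  3+f₂≤ = ≤-trans (next-exponent≤ k f₁)
           (≤-trans (*-monoʳ-≤ (3 * K) (next-exponent≤ k s)) (≤-reflexive (lemma K B)))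
    where
    lemma : ∀ K B → 3 * K * (3 * K * B) ≡ 9 * (K * K * B)
    lemma = solve-∀

  3+f₃≤ : 3 + f₃ ≤ 27 * (K * K * K * B)
  3+f₃≤ = ≤-trans (next-exponent≤ k f₂)
           (≤-trans (*-monoʳ-≤ (3 * K) 3+f₂≤) (≤-reflexive (lemma K B)))
    where
    lemma : ∀ K B → 3 * K * (9 * (K * K * B)) ≡ 27 * (K * K * K * B)
    lemma = solve-∀

  A-large : ∀ {a f} → 3 + f ≤ 9 * (K * K * B) → 2 ^ (K * K * (v * v)) ≤ a → 2 ^ (2 + f) * K ≤ a
  A-large {a} {f} 3+f≤ 2^[KKvv]≤a = large-from-exponent {f} {K} {1} {a} (begin
    2 + f + K + 1                  ≡⟨ lemma f K ⟩
    (3 + f) + K                    ≤⟨ +-mono-≤ 3+f≤ K≤KKB ⟩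
    9 * (K * K * B) + K * K * B    ≡⟨ lemma′ K B ⟩
    K * K * (10 * B)               ≤⟨ *-monoʳ-≤ (K * K) 10B≤vv ⟩
    K * K * (v * v)                ∎) (subst (2 ^ (K * K * (v * v)) ≤_) (sym (*-identityʳ a)) 2^[KKvv]≤a)
    where
    open ≤-Reasoning
    K≤KKB : K ≤ K * K * B
    K≤KKB = ≤-trans (m≤m*n K (K * B)) (≤-reflexive (sym (*-assoc K K B)))
    10B≤vv : 10 * B ≤ v * v
    10B≤vv = ≤-trans (*-monoˡ-≤ B (m≤m+n 10 17))
               (≤-trans (≤-trans (m≤m+n _ q₂) (n≤1+n _)) (m≤m*n v v))
    lemma : ∀ f K → 2 + f + K + 1 ≡ (3 + f) + K
    lemma = solve-∀
    lemma′ : ∀ K B → 9 * (K * K * B) + K * K * B ≡ K * K * (10 * B)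
    lemma′ = solve-∀

  Kv≤2^[KKvv] : K * v ≤ 2 ^ (K * K * (v * v))
  Kv≤2^[KKvv] = ≤-trans (m≤m*n (K * v) (K * v)) (≤-trans (≤-reflexive (lemma K v)) (n≤2^n _))
    where
    lemma : ∀ K v → K * v * (K * v) ≡ K * K * (v * v)
    lemma = solve-∀

  Z-large : ∀ {z m} .{{_ : NonZero q₂}} →
            K * v ≤ m → 2 ^ (m * m * m) ≤ z * q₂ → 2 ^ (2 + f₃) * K ≤ z
  Z-large {z} {m} Kv≤m = large-from-exponent {f₃} {K} {q₂} {z} (begin
    2 + f₃ + K + q₂                                        ≤⟨ +-mono-≤ (+-mono-≤ (n≤1+n (2 + f₃)) K≤K³) q₂≤K³q₂ ⟩
    3 + f₃ + K * (K * K) + K * (K * K) * q₂                ≤⟨ +-monoˡ-≤ _ (+-monoˡ-≤ _ 3+f₃≤) ⟩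
    27 * (K * K * K * B) + K * (K * K) + K * (K * K) * q₂  ≡⟨ lemma K B q₂ ⟩
    K * K * K * v                                          ≤⟨ *-monoʳ-≤ (K * K * K) (m≤m*n v (v * v)) ⟩
    K * K * K * (v * (v * v))                              ≡⟨ lemma′ K v ⟩
    K * v * (K * v) * (K * v)                              ≤⟨ *-mono-≤ (*-mono-≤ Kv≤m Kv≤m) Kv≤m ⟩
    m * m * m                                              ∎)
    where
    open ≤-Reasoning
    K≤K³ : K ≤ K * (K * K)
    K≤K³ = m≤m*n K (K * K)
    q₂≤K³q₂ : q₂ ≤ K * (K * K) * q₂
    q₂≤K³q₂ = m≤n*m q₂ (K * (K * K))
    lemma : ∀ K B q → 27 * (K * K * K * B) + K * (K * K) + K * (K * K) * q ≡ K * K * K * suc (27 * B + q)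
    lemma = solve-∀
    lemma′ : ∀ K v → K * K * K * (v * (v * v)) ≡ K * v * (K * v) * (K * v)
    lemma′ = solve-∀

  large-classes : ∀ {a z m} .{{_ : NonZero q₂}} →
                  2 ^ (K * K * (v * v)) ≤ a → a ≤ m → 2 ^ (m * m * m) ≤ z * q₂ →
                  Large K s (a ∷ a ∷ a ∷ z ∷ [])
  large-classes 2^[KKvv]≤a a≤m 2^mmm≤zq₂ =
    A-large 3+f₀≤ 2^[KKvv]≤a , A-large 3+f₁≤ 2^[KKvv]≤a , A-large 3+f₂≤ 2^[KKvv]≤a ,
    Z-large (≤-trans (≤-trans Kv≤2^[KKvv] 2^[KKvv]≤a) a≤m) 2^mmm≤zq₂ , tt

aq≡pm⇒a≤m : ∀ {a m p q} → a * q ≡ p * m → p < q → a ≤ m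
aq≡pm⇒a≤m {a} {m} {p} {q} aq≡pm p<q = *-cancelʳ-≤ a m q {{>-nonZero (≤-trans (s≤s z≤n) p<q)}}
  (≤-trans (≤-reflexive aq≡pm) (≤-trans (*-monoˡ-≤ m (<⇒≤ p<q)) (≤-reflexive (*-comm q m))))

edge-density : ∀ {a z r s E} → 0 < r → 2 * r * (z * a * a * a) ≤ s * E →
               product (a ∷ a ∷ a ∷ z ∷ []) ≤ 2 ^ s * E
edge-density {a} {z} {r} {s} {E} 0<r dense = begin
  a * (a * (a * (z * 1)))   ≡⟨ lemma a z ⟩
  z * a * a * a             ≤⟨ m≤n*m _ (2 * r) {{>-nonZero (≤-trans 0<r (m≤n*m r 2))}} ⟩
  2 * r * (z * a * a * a)   ≤⟨ dense ⟩
  s * E                     ≤⟨ *-monoˡ-≤ E (n≤2^n s) ⟩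
  2 ^ s * E                 ∎
  where
  open ≤-Reasoning
  lemma : ∀ a z → a * (a * (a * (z * 1))) ≡ z * a * a * a
  lemma = solve-∀

lemma4 : (p₁ q₁ p₂ q₂ : ℕ) → 0 < p₁ → p₁ < q₁ → 0 < p₂ → p₂ < q₂ →
         (r s : ℕ) → 0 < r → 0 < s →
         Σ ℕ (λ u → Σ ℕ (λ v → 0 < u × 0 < v ×
           ((m : ℕ) → 1 ≤ m → (a z : ℕ) →
            a * q₁ ≡ p₁ * m → z * q₂ ≡ p₂ * 2 ^ (m * m * m) →
            (H : FourPartite a a a z) →
            2 * r * (z * a * a * a) ≤ s * edgeCount H →
            (k : ℕ) → 2 ^ (k * k * (v * v)) ≤ a ^ (u * u) →
            Σ (Subset a) (λ A' → Σ (Subset a) (λ B' → Σ (Subset a) (λ C' →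
              Σ (Subset z) (λ Z' →
                ∣ A' ∣ ≡ k × ∣ B' ∣ ≡ k × ∣ C' ∣ ≡ k × ∣ Z' ∣ ≡ k ×
                Complete H A' B' C' Z')))))))
lemma4 p₁ q₁ p₂ q₂ _ p₁<q₁ 0<p₂ p₂<q₂ r s 0<r _ = 1 , β⁻¹ s q₂ , s≤s z≤n , s≤s z≤n , λ where
  m _ a z a-def z-def H dense zero    _        → empty-subgraph H
  m _ a z a-def z-def H dense (suc k) 2^e≤a^1 →
    complete-subgraph H {suc k} {s} (s≤s z≤n)
      (ClassSizes.large-classes k s q₂ {{>-nonZero (<-trans 0<p₂ p₂<q₂)}}
        (subst (2 ^ (suc k * suc k * (β⁻¹ s q₂ * β⁻¹ s q₂)) ≤_) (^-identityʳ a) 2^e≤a^1)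
        (aq≡pm⇒a≤m a-def p₁<q₁)
        (≤-trans (m≤n*m _ p₂ {{>-nonZero 0<p₂}}) (≤-reflexive (sym z-def))))
      (edge-density {a} {z} {r} {s} 0<r dense)
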